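{- Let $A=(a_{ijk})_{i,j,k\in\{1,2\}}$ be a $2\times2\times2$ hypermatrix with integer entries, with associated trilinear form $f(\mathbf{x},\mathbf{y},\mathbf{z})=\sum_{i,j,k}a_{ijk}x_iy_jz_k$ and Cayley hyperdeterminant $D$. Let $q$ be a non-zero integer and suppose there exists a primitive vector $\mathbf{z}=(z_1,z_2)\in\mathbb{Z}^2$ (i.e. $\gcd(z_1,z_2)=1$) such that $q$ divides $a_{ij1}z_1+a_{ij2}z_2$ for all $i,j\in\{1,2\}$. Then $q^2\mid D$.
   Context: The Cayley hyperdeterminant is $D=a_{122}^2a_{211}^2+a_{111}^2a_{222}^2+a_{212}^2a_{121}^2+a_{112}^2a_{221}^2-2a_{111}a_{122}a_{211}a_{222}-2a_{211}a_{122}a_{112}a_{221}-2a_{211}a_{122}a_{212}a_{121}-2a_{222}a_{111}a_{212}a_{121}-2a_{222}a_{111}a_{112}a_{221}-2a_{112}a_{121}a_{212}a_{221}+4a_{112}a_{121}a_{211}a_{222}+4a_{111}a_{122}a_{212}a_{221}$. The linear forms $a_{ij1}z_1+a_{ij2}z_2$ are the coefficients of $f(\mathbf{x},\mathbf{y},\mathbf{z})$ viewed as a bilinear form in $\mathbf{x},\mathbf{y}$. -}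

module Defs where

open import Data.Fin using (Fin; zero; suc)
open import Data.Integer using (ℤ; _+_; _-_; _*_; +_)

-- A 2×2×2 hypermatrix with integer entries; index zero ↦ 1, suc zero ↦ 2.
Hypermatrix : Set
Hypermatrix = Fin 2 → Fin 2 → Fin 2 → ℤ

i1 i2 : Fin 2
i1 = zero
i2 = suc zero

cayleyD : Hypermatrix → ℤ
cayleyD a =
  let a111 = a i1 i1 i1 ; a112 = a i1 i1 i2 ; a121 = a i1 i2 i1 ; a122 = a i1 i2 i2
      a211 = a i2 i1 i1 ; a212 = a i2 i1 i2 ; a221 = a i2 i2 i1 ; a222 = a i2 i2 i2
  in   a122 * a122 * a211 * a211 + a111 * a111 * a222 * a222
     + a212 * a212 * a121 * a121 + a112 * a112 * a221 * a221
     - + 2 * a111 * a122 * a211 * a222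
     - + 2 * a211 * a122 * a112 * a221
     - + 2 * a211 * a122 * a212 * a121
     - + 2 * a222 * a111 * a212 * a121
     - + 2 * a222 * a111 * a112 * a221
     - + 2 * a112 * a121 * a212 * a221
     + + 4 * a112 * a121 * a211 * a222
     + + 4 * a111 * a122 * a212 * a221

linForm : Hypermatrix → Fin 2 → Fin 2 → ℤ → ℤ → ℤ
linForm a i j z₁ z₂ = a i j i1 * z₁ + a i j i2 * z₂

{-# OPTIONS --safe #-}

-- With A and B the slices a_{ij1} and a_{ij2}, the hyperdeterminant is the
-- discriminant of the binary quadratic form det (s A + t B). A change of the
-- variables (s, t) of determinant 1 leaves this discriminant unchanged. Complete
-- the primitive vector z to such a basis (z, w): the new first slice z₁ A + z₂ B
-- is q times an integer matrix, so its determinant is divisible by q² and its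
-- polar pairing with the second slice by q, whence q² divides the discriminant.
module Submission where

open import Defs
open import Data.Fin using (Fin)
open import Data.Integer using (ℤ; _+_; _-_; _*_; -_; +_; -[1+_]; ∣_∣; 0ℤ; -1ℤ)
open import Data.Integer.Divisibility using (_∣_)
import Data.Integer.Divisibility.Signed as Signed
open import Data.Integer.GCD using (gcd)
open import Data.Integer.Properties
  using (+-comm; *-assoc; *-identityˡ; -1*i≡-i; +-injective; pos-+; pos-*)
open import Data.Integer.Tactic.RingSolver using (solve-∀)
import Data.Nat as ℕ
open import Data.Nat.GCD using (module Bézout)
open import Data.Nat.Coprimality using (gcd≡1⇒coprime; coprime-Bézout)
open import Data.Product using (_,_; ∃; ∃₂)
open import Relation.Binary.PropositionalEquality
  using (_≡_; _≢_; refl; sym; trans; cong; cong₂; subst; module ≡-Reasoning)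

open ≡-Reasoning

Matrix₂ : Set
Matrix₂ = Fin 2 → Fin 2 → ℤ

det : Matrix₂ → ℤ
det X = X i1 i1 * X i2 i2 - X i1 i2 * X i2 i1

-- The coefficient of s t in det (s X + t Y).
polarDet : Matrix₂ → Matrix₂ → ℤ
polarDet X Y = X i1 i1 * Y i2 i2 + Y i1 i1 * X i2 i2 - X i1 i2 * Y i2 i1 - Y i1 i2 * X i2 i1

discriminant : ℤ → ℤ → ℤ → ℤ
discriminant α β γ = β * β - + 4 * α * γ

pencilDiscriminant : Matrix₂ → Matrix₂ → ℤ
pencilDiscriminant X Y = discriminant (det X) (polarDet X Y) (det Y)

combine : Matrix₂ → Matrix₂ → ℤ → ℤ → Matrix₂
combine X Y s t i j = X i j * s + Y i j * t

slice : Hypermatrix → Fin 2 → Matrix₂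
slice a k i j = a i j k

-- The ring solver does not unfold definitions, so each polynomial identity below is
-- restated on explicit entries in a local lemma `expand`.
cayleyD≡pencilDiscriminant : ∀ a → cayleyD a ≡ pencilDiscriminant (slice a i1) (slice a i2)
cayleyD≡pencilDiscriminant a =
  expand (a i1 i1 i1) (a i1 i1 i2) (a i1 i2 i1) (a i1 i2 i2) (a i2 i1 i1) (a i2 i1 i2) (a i2 i2 i1) (a i2 i2 i2)
  where
  expand : ∀ a111 a112 a121 a122 a211 a212 a221 a222 →
      a122 * a122 * a211 * a211 + a111 * a111 * a222 * a222
    + a212 * a212 * a121 * a121 + a112 * a112 * a221 * a221
    - + 2 * a111 * a122 * a211 * a222
    - + 2 * a211 * a122 * a112 * a221
    - + 2 * a211 * a122 * a212 * a121
    - + 2 * a222 * a111 * a212 * a121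
    - + 2 * a222 * a111 * a112 * a221
    - + 2 * a112 * a121 * a212 * a221
    + + 4 * a112 * a121 * a211 * a222
    + + 4 * a111 * a122 * a212 * a221
    ≡ (a111 * a222 + a112 * a221 - a121 * a212 - a122 * a211) * (a111 * a222 + a112 * a221 - a121 * a212 - a122 * a211)
      - + 4 * (a111 * a221 - a121 * a211) * (a112 * a222 - a122 * a212)
  expand = solve-∀

det-combine : ∀ X Y s t →
  det (combine X Y s t) ≡ det X * s * s + polarDet X Y * s * t + det Y * t * t
det-combine X Y s t = expand (X i1 i1) (X i1 i2) (X i2 i1) (X i2 i2) (Y i1 i1) (Y i1 i2) (Y i2 i1) (Y i2 i2) s t
  where
  expand : ∀ x₁₁ x₁₂ x₂₁ x₂₂ y₁₁ y₁₂ y₂₁ y₂₂ s t →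
    (x₁₁ * s + y₁₁ * t) * (x₂₂ * s + y₂₂ * t) - (x₁₂ * s + y₁₂ * t) * (x₂₁ * s + y₂₁ * t)
    ≡ (x₁₁ * x₂₂ - x₁₂ * x₂₁) * s * s
      + (x₁₁ * y₂₂ + y₁₁ * x₂₂ - x₁₂ * y₂₁ - y₁₂ * x₂₁) * s * t
      + (y₁₁ * y₂₂ - y₁₂ * y₂₁) * t * t
  expand = solve-∀

polarDet-combine : ∀ X Y z₁ z₂ w₁ w₂ →
  polarDet (combine X Y z₁ z₂) (combine X Y w₁ w₂)
  ≡ + 2 * det X * z₁ * w₁ + polarDet X Y * (z₁ * w₂ + z₂ * w₁) + + 2 * det Y * z₂ * w₂
polarDet-combine X Y =
  expand (X i1 i1) (X i1 i2) (X i2 i1) (X i2 i2) (Y i1 i1) (Y i1 i2) (Y i2 i1) (Y i2 i2)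
  where
  expand : ∀ x₁₁ x₁₂ x₂₁ x₂₂ y₁₁ y₁₂ y₂₁ y₂₂ z₁ z₂ w₁ w₂ →
      (x₁₁ * z₁ + y₁₁ * z₂) * (x₂₂ * w₁ + y₂₂ * w₂) + (x₁₁ * w₁ + y₁₁ * w₂) * (x₂₂ * z₁ + y₂₂ * z₂)
    - (x₁₂ * z₁ + y₁₂ * z₂) * (x₂₁ * w₁ + y₂₁ * w₂) - (x₁₂ * w₁ + y₁₂ * w₂) * (x₂₁ * z₁ + y₂₁ * z₂)
    ≡ + 2 * (x₁₁ * x₂₂ - x₁₂ * x₂₁) * z₁ * w₁
      + (x₁₁ * y₂₂ + y₁₁ * x₂₂ - x₁₂ * y₂₁ - y₁₂ * x₂₁) * (z₁ * w₂ + z₂ * w₁)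
      + + 2 * (y₁₁ * y₂₂ - y₁₂ * y₂₁) * z₂ * w₂
  expand = solve-∀

-- The arguments are the coefficients of α s² + β s t + γ t² after (s, t) ↦ s z + t w.
discriminant-substitution : ∀ α β γ z₁ z₂ w₁ w₂ →
  discriminant (α * z₁ * z₁ + β * z₁ * z₂ + γ * z₂ * z₂)
               (+ 2 * α * z₁ * w₁ + β * (z₁ * w₂ + z₂ * w₁) + + 2 * γ * z₂ * w₂)
               (α * w₁ * w₁ + β * w₁ * w₂ + γ * w₂ * w₂)
  ≡ (z₁ * w₂ - z₂ * w₁) * (z₁ * w₂ - z₂ * w₁) * discriminant α β γ
discriminant-substitution = expand
  where
  expand : ∀ α β γ z₁ z₂ w₁ w₂ →
      (+ 2 * α * z₁ * w₁ + β * (z₁ * w₂ + z₂ * w₁) + + 2 * γ * z₂ * w₂)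
    * (+ 2 * α * z₁ * w₁ + β * (z₁ * w₂ + z₂ * w₁) + + 2 * γ * z₂ * w₂)
    - + 4 * (α * z₁ * z₁ + β * z₁ * z₂ + γ * z₂ * z₂) * (α * w₁ * w₁ + β * w₁ * w₂ + γ * w₂ * w₂)
    ≡ (z₁ * w₂ - z₂ * w₁) * (z₁ * w₂ - z₂ * w₁) * (β * β - + 4 * α * γ)
  expand = solve-∀

pencilDiscriminant-combine : ∀ X Y z₁ z₂ w₁ w₂ →
  pencilDiscriminant (combine X Y z₁ z₂) (combine X Y w₁ w₂)
  ≡ (z₁ * w₂ - z₂ * w₁) * (z₁ * w₂ - z₂ * w₁) * pencilDiscriminant X Y
pencilDiscriminant-combine X Y z₁ z₂ w₁ w₂ = begin
  discriminant (det (combine X Y z₁ z₂)) (polarDet (combine X Y z₁ z₂) (combine X Y w₁ w₂))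
               (det (combine X Y w₁ w₂))
    ≡⟨ cong₂ (λ u v → discriminant u v (det (combine X Y w₁ w₂)))
             (det-combine X Y z₁ z₂) (polarDet-combine X Y z₁ z₂ w₁ w₂) ⟩
  discriminant (det X * z₁ * z₁ + polarDet X Y * z₁ * z₂ + det Y * z₂ * z₂)
               (+ 2 * det X * z₁ * w₁ + polarDet X Y * (z₁ * w₂ + z₂ * w₁) + + 2 * det Y * z₂ * w₂)
               (det (combine X Y w₁ w₂))
    ≡⟨ cong (discriminant (det X * z₁ * z₁ + polarDet X Y * z₁ * z₂ + det Y * z₂ * z₂)
                          (+ 2 * det X * z₁ * w₁ + polarDet X Y * (z₁ * w₂ + z₂ * w₁) + + 2 * det Y * z₂ * w₂))
            (det-combine X Y w₁ w₂) ⟩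
  discriminant (det X * z₁ * z₁ + polarDet X Y * z₁ * z₂ + det Y * z₂ * z₂)
               (+ 2 * det X * z₁ * w₁ + polarDet X Y * (z₁ * w₂ + z₂ * w₁) + + 2 * det Y * z₂ * w₂)
               (det X * w₁ * w₁ + polarDet X Y * w₁ * w₂ + det Y * w₂ * w₂)
    ≡⟨ discriminant-substitution (det X) (polarDet X Y) (det Y) z₁ z₂ w₁ w₂ ⟩
  (z₁ * w₂ - z₂ * w₁) * (z₁ * w₂ - z₂ * w₁) * pencilDiscriminant X Y ∎

pencilDiscriminant-unimodular : ∀ X Y z₁ z₂ w₁ w₂ → z₁ * w₂ - z₂ * w₁ ≡ + 1 →
  pencilDiscriminant X Y ≡ pencilDiscriminant (combine X Y z₁ z₂) (combine X Y w₁ w₂)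
pencilDiscriminant-unimodular X Y z₁ z₂ w₁ w₂ det≡1 = begin
  pencilDiscriminant X Y                                              ≡⟨ *-identityˡ _ ⟨
  + 1 * + 1 * pencilDiscriminant X Y                                  ≡⟨ cong (λ e → e * e * pencilDiscriminant X Y) det≡1 ⟨
  (z₁ * w₂ - z₂ * w₁) * (z₁ * w₂ - z₂ * w₁) * pencilDiscriminant X Y  ≡⟨ pencilDiscriminant-combine X Y z₁ z₂ w₁ w₂ ⟨
  pencilDiscriminant (combine X Y z₁ z₂) (combine X Y w₁ w₂)          ∎

pencilDiscriminant-scaleˡ : ∀ q X C Y → (∀ i j → X i j ≡ C i j * q) →
  pencilDiscriminant X Y ≡ pencilDiscriminant C Y * (q * q)
pencilDiscriminant-scaleˡ q X C Y X≡Cq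
  rewrite X≡Cq i1 i1 | X≡Cq i1 i2 | X≡Cq i2 i1 | X≡Cq i2 i2 =
  expand (C i1 i1) (C i1 i2) (C i2 i1) (C i2 i2) (Y i1 i1) (Y i1 i2) (Y i2 i1) (Y i2 i2) q
  where
  expand : ∀ c₁₁ c₁₂ c₂₁ c₂₂ y₁₁ y₁₂ y₂₁ y₂₂ q →
      (c₁₁ * q * y₂₂ + y₁₁ * (c₂₂ * q) - c₁₂ * q * y₂₁ - y₁₂ * (c₂₁ * q))
    * (c₁₁ * q * y₂₂ + y₁₁ * (c₂₂ * q) - c₁₂ * q * y₂₁ - y₁₂ * (c₂₁ * q))
    - + 4 * (c₁₁ * q * (c₂₂ * q) - c₁₂ * q * (c₂₁ * q)) * (y₁₁ * y₂₂ - y₁₂ * y₂₁)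
    ≡ ((c₁₁ * y₂₂ + y₁₁ * c₂₂ - c₁₂ * y₂₁ - y₁₂ * c₂₁) * (c₁₁ * y₂₂ + y₁₁ * c₂₂ - c₁₂ * y₂₁ - y₁₂ * c₂₁)
      - + 4 * (c₁₁ * c₂₂ - c₁₂ * c₂₁) * (y₁₁ * y₂₂ - y₁₂ * y₂₁)) * (q * q)
  expand = solve-∀

pencilDiscriminant-divisibleˡ : ∀ q X Y → (∀ i j → q ∣ X i j) → q * q ∣ pencilDiscriminant X Y
pencilDiscriminant-divisibleˡ q X Y q∣X =
  Signed.∣⇒∣ᵤ {q * q} (Signed.divides (pencilDiscriminant C Y) (pencilDiscriminant-scaleˡ q X C Y X≡Cq))
  where
  q∣ₛX : ∀ i j → q Signed.∣ X i j
  q∣ₛX i j = Signed.∣ᵤ⇒∣ {q} {X i j} (q∣X i j)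
  C : Matrix₂
  C i j = Signed._∣_.quotient (q∣ₛX i j)
  X≡Cq : ∀ i j → X i j ≡ C i j * q
  X≡Cq i j = Signed._∣_.equality (q∣ₛX i j)

abs-as-multiple : ∀ i → ∃ λ s → + ∣ i ∣ ≡ s * i
abs-as-multiple (+ n)    = + 1 , sym (*-identityˡ (+ n))
abs-as-multiple -[1+ n ] = -1ℤ , sym (-1*i≡-i -[1+ n ])

ℕ-Bézout⇒ℤ : ∀ {m n} → Bézout.Identity 1 m n → ∃₂ λ u v → u * + m + v * + n ≡ + 1
ℕ-Bézout⇒ℤ {m} {n} (Bézout.+- x y eq) = + x , - + y , cancel (+ x) (+ m) (+ y) (+ n) eqℤ
  where
  eqℤ : + 1 + + y * + n ≡ + x * + m
  eqℤ = begin
    + 1 + + y * + n     ≡⟨ cong (_+_ (+ 1)) (pos-* y n) ⟨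
    + 1 + + (y ℕ.* n)   ≡⟨ pos-+ 1 (y ℕ.* n) ⟨
    + (1 ℕ.+ y ℕ.* n)   ≡⟨ cong +_ eq ⟩
    + (x ℕ.* m)         ≡⟨ pos-* x m ⟩
    + x * + m           ∎
  cancel : ∀ a b c d → + 1 + c * d ≡ a * b → a * b + - c * d ≡ + 1
  cancel a b c d eq rewrite sym eq = identity c d
    where
    identity : ∀ c d → + 1 + c * d + - c * d ≡ + 1
    identity = solve-∀
ℕ-Bézout⇒ℤ {m} {n} (Bézout.-+ x y eq) with ℕ-Bézout⇒ℤ (Bézout.+- y x eq)
... | u , v , un+vm≡1 = v , u , trans (+-comm (v * + m) (u * + n)) un+vm≡1

bézout : ∀ i j → gcd i j ≡ + 1 → ∃₂ λ u v → u * i + v * j ≡ + 1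
bézout i j gcd≡1
  with ℕ-Bézout⇒ℤ (coprime-Bézout (gcd≡1⇒coprime (+-injective gcd≡1)))
     | abs-as-multiple i | abs-as-multiple j
... | u , v , u∣i∣+v∣j∣≡1 | s , ∣i∣≡si | t , ∣j∣≡tj = u * s , v * t , (begin
  u * s * i + v * t * j         ≡⟨ cong₂ _+_ (*-assoc u s i) (*-assoc v t j) ⟩
  u * (s * i) + v * (t * j)     ≡⟨ cong₂ (λ a b → u * a + v * b) ∣i∣≡si ∣j∣≡tj ⟨
  u * + ∣ i ∣ + v * + ∣ j ∣     ≡⟨ u∣i∣+v∣j∣≡1 ⟩
  + 1                           ∎)

primitive⇒unimodular : ∀ z₁ z₂ → gcd z₁ z₂ ≡ + 1 → ∃₂ λ w₁ w₂ → z₁ * w₂ - z₂ * w₁ ≡ + 1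
primitive⇒unimodular z₁ z₂ gcd≡1 with bézout z₁ z₂ gcd≡1
... | u , v , uz₁+vz₂≡1 = - v , u , trans (rearrange z₁ z₂ u v) uz₁+vz₂≡1
  where
  rearrange : ∀ z₁ z₂ u v → z₁ * u - z₂ * - v ≡ u * z₁ + v * z₂
  rearrange = solve-∀

mainTheorem5 : (a : Hypermatrix) (q : ℤ) → q ≢ 0ℤ →
    (z₁ z₂ : ℤ) → gcd z₁ z₂ ≡ + 1 →
    ((i j : Fin 2) → q ∣ linForm a i j z₁ z₂) →
    (q * q) ∣ cayleyD a
mainTheorem5 a q _ z₁ z₂ gcd≡1 q∣L =
  let w₁ , w₂ , det≡1 = primitive⇒unimodular z₁ z₂ gcd≡1
      A = slice a i1
      B = slice a i2
      L = combine A B z₁ z₂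
      M = combine A B w₁ w₂
      change-of-basis : cayleyD a ≡ pencilDiscriminant L M
      change-of-basis = trans (cayleyD≡pencilDiscriminant a) (pencilDiscriminant-unimodular A B z₁ z₂ w₁ w₂ det≡1)
  in subst (q * q ∣_) (sym change-of-basis) (pencilDiscriminant-divisibleˡ q L M q∣L)
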